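{- For each integer $n \ge 2$ let $l_n$ be a non-decreasing integer-valued sequence with $l_n(1) = 2^{n-1}$ and $l_n(k+1)-l_n(k) \in G_n = \{\sum_{i=1}^{b}2^{n-i} : 1 \le b \le n\}$ for all $k$, and define $D_{1,n} = \{l_n(k)\}_{k=1}^\infty$ and, for $2 \le j \le n$, $D_{j,n} = D_{1,n} \pm 2^{n-2} \pm 2^{n-3} \pm \cdots \pm 2^{n-j}$ (so $D_{1,n},\ldots,D_{n,n}$ partition the positive integers). Let $M$ be the set of positive odd integers. Then for every fixed integer $e \ge 0$, $D_{n-e,n} \to 2^e \cdot M$ pointwise as $n \to \infty$; that is, for every positive integer $m$ there is $N$ such that for all $n \ge N$ (with $n > e$), $m \in D_{n-e,n}$ if and only if $m \in 2^e\cdot M$.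
   Context: For a set $X$ of integers and an integer $r$, $X \pm r = \{x+r : x\in X\}\cup\{x-r : x \in X\}$, iterated left to right. $2^e \cdot M = \{2^e x : x \in M\}$. -}

module Defs where

open import Data.Nat using (ℕ; zero; suc; _∸_; _^_; _≤_)
import Data.Nat as ℕ
open import Data.Integer using (ℤ; +_; _+_; _-_)
import Data.Integer as ℤ
open import Data.Product using (Σ; ∃; ∃-syntax; _×_)
open import Data.Sum using (_⊎_)
open import Data.Empty using (⊥)
open import Relation.Binary.PropositionalEquality using (_≡_)

partialSum : ℕ → ℕ → ℕ
partialSum n zero = 0
partialSum n (suc b) = partialSum n b ℕ.+ 2 ^ (n ∸ suc b)

InG : ℕ → ℤ → Set
InG n d = ∃[ b ] (1 ≤ b × b ≤ n × d ≡ + partialSum n b)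

-- l : ℕ → ℤ is the sequence l_n (only indices k ≥ 1 are used)
IsLSeq : ℕ → (ℕ → ℤ) → Set
IsLSeq n l =
  (l 1 ≡ + (2 ^ (n ∸ 1))) ×
  (∀ k → 1 ≤ k → l k ℤ.≤ l (suc k)) ×
  (∀ k → 1 ≤ k → InG n (l (suc k) - l k))

-- InD l n j x  :  x ∈ D_{j,n}   (j ≥ 1; j = 0 is the empty set, unused)
-- D_{1,n} = { l(k) : k ≥ 1 },  D_{j+1,n} = D_{j,n} ± 2^(n-(j+1))
InD : (ℕ → ℤ) → ℕ → ℕ → ℤ → Set
InD l n zero x = ⊥
InD l n (suc zero) x = ∃[ k ] (1 ≤ k × x ≡ l k)
InD l n (suc (suc j)) x =
  ∃[ y ] (InD l n (suc j) y ×
    (x ≡ y + + (2 ^ (n ∸ suc (suc j))) ⊎ x ≡ y - + (2 ^ (n ∸ suc (suc j)))))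

InTwoPowOdd : ℕ → ℤ → Set
InTwoPowOdd e m = ∃[ q ] (m ≡ + (2 ^ e ℕ.* (2 ℕ.* q ℕ.+ 1)))

module Submission where

-- Fix n and write A = 2^(n-1).  Every increment of l_n lies in
-- G_n, whose elements all contain the term 2^(n-1); so l_n(1) = A and
-- l_n(k) ≥ 2A for k ≥ 2.  Following the ± construction level by level one
-- shows, for 1 ≤ j+1 ≤ n and p = n-(j+1):
--   * (classification) every x ∈ D_{j+1,n} is an odd multiple of 2^p or
--     satisfies x ≥ A + 2^p, because y = 2^(p+1)·odd gives y ± 2^p = 2^p·odd
--     and y ≥ A + 2^(p+1) gives y ± 2^p ≥ A + 2^p;
--   * (realisation) every 2^p·(2q+1) with q < 2^j lies in D_{j+1,n}, because
--     it is 2^(p+1)·(2⌊q/2⌋+1) ± 2^p, and induction applies to the parent.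
-- Hence below A the level D_{j+1,n} is exactly the set of odd multiples of
-- 2^p.  For fixed e and m, once n > m we have m ≤ n-1 < 2^(n-1) = A, and the
-- level D_{n-e,n} (j+1 = n-e, p = e) is decided by this description.

open import Defs
open import Data.Nat using (ℕ; _≤_; _<_; _∸_)
open import Data.Integer using (ℤ; +_)
open import Data.Product using (∃-syntax)
open import Function.Bundles using (_⇔_)

open import Data.Nat using (zero; suc; _+_; _*_; _^_; z≤n; s≤s; z<s)
import Data.Nat.Properties as ℕP
import Data.Integer as ℤ
import Data.Integer.Properties as ℤP
import Data.Nat.Tactic.RingSolver as ℕSolver
import Data.Integer.Tactic.RingSolver as ℤSolver
open import Data.Product using (_,_; _×_; proj₁; proj₂)
open import Data.Sum using (_⊎_; inj₁; inj₂)
open import Relation.Binary.PropositionalEquality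
open import Relation.Nullary using (contradiction)
open import Function.Bundles using (mk⇔)

infix 4 _IsStep_By_
_IsStep_By_ : ℤ → ℤ → ℕ → Set
x IsStep y By p = x ≡ y ℤ.+ + (2 ^ p) ⊎ x ≡ y ℤ.- + (2 ^ p)

Classified : ℕ → ℕ → ℤ → Set
Classified a p x = InTwoPowOdd p x ⊎ + (a + 2 ^ p) ℤ.≤ x

n<2^n : ∀ n → n < 2 ^ n
n<2^n zero = s≤s z≤n
n<2^n (suc n) =
  ℕP.+-mono-≤ (ℕP.m^n>0 2 n) (subst (suc n ≤_) (sym (ℕP.+-identityʳ (2 ^ n))) (n<2^n n))

∸-peel : ∀ {n k} → suc k ≤ n → n ∸ k ≡ suc (n ∸ suc k)
∸-peel {n} {k} k<n = ℕP.+-∸-assoc 1 {n} {suc k} k<n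

even-or-odd : ∀ q → ∃[ r ] (q ≡ 2 * r ⊎ q ≡ 2 * r + 1)
even-or-odd zero = 0 , inj₁ refl
even-or-odd (suc q) with even-or-odd q
... | r , inj₁ refl = r , inj₂ (ℕP.+-comm 1 (2 * r))
... | r , inj₂ refl = suc r , inj₁ (twice-suc r)
  where
  twice-suc : ∀ r → suc (2 * r + 1) ≡ 2 * suc r
  twice-suc = ℕSolver.solve-∀

pos-+-minus : ∀ a P → + (a + P) ℤ.- + P ≡ + a
pos-+-minus a P = trans (cong (ℤ._- + P) (ℤP.pos-+ a P)) (cancel (+ a) (+ P))
  where
  cancel : ∀ i j → (i ℤ.+ j) ℤ.- j ≡ i
  cancel = ℤSolver.solve-∀

odd-above : ∀ P c → + (2 * P * c) ℤ.+ + P ≡ + (P * (2 * c + 1))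
odd-above P c = trans (sym (ℤP.pos-+ (2 * P * c) P)) (cong +_ (identity P c))
  where
  identity : ∀ P c → 2 * P * c + P ≡ P * (2 * c + 1)
  identity = ℕSolver.solve-∀

odd-below : ∀ P r → + (2 * P * (2 * r + 1)) ℤ.- + P ≡ + (P * (2 * (2 * r) + 1))
odd-below P r = trans (cong (λ t → + t ℤ.- + P) (identity P r)) (pos-+-minus _ P)
  where
  identity : ∀ P r → 2 * P * (2 * r + 1) ≡ P * (2 * (2 * r) + 1) + P
  identity = ℕSolver.solve-∀

twoPowOdd-step : ∀ p y x → InTwoPowOdd (suc p) y → x IsStep y By p → InTwoPowOdd p x
twoPowOdd-step p y x (q , refl) (inj₁ refl) = 2 * q + 1 , odd-above (2 ^ p) (2 * q + 1)
twoPowOdd-step p y x (q , refl) (inj₂ refl) = 2 * q , odd-below (2 ^ p) q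

-- Conversely every 2^p·(2q+1) is a step ± 2^p from its parent 2^(p+1)·(2r+1),
-- r = ⌊q/2⌋; the bound q < 2K descends to r < K.
twoPowOdd-parent : ∀ p q K → q < 2 * K →
  ∃[ r ] (r < K × + (2 ^ p * (2 * q + 1)) IsStep + (2 ^ suc p * (2 * r + 1)) By p)
twoPowOdd-parent p q K q<2K with even-or-odd q
... | r , inj₁ refl = r , ℕP.*-cancelˡ-< 2 r K q<2K , inj₂ (sym (odd-below (2 ^ p) r))
... | r , inj₂ refl = r , ℕP.*-cancelˡ-< 2 r K (ℕP.≤-trans (s≤s (ℕP.m≤m+n (2 * r) 1)) q<2K)
                        , inj₁ (sym (odd-above (2 ^ p) (2 * r + 1)))

margin-step : ∀ a p y x → + (a + 2 ^ suc p) ℤ.≤ y → x IsStep y By p → + (a + 2 ^ p) ℤ.≤ x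
margin-step a p y x a+2P≤y x=y±P =
  ℤP.≤-trans (subst (ℤ._≤ y ℤ.- + P) (pos-+-minus (a + P) P) y-P-bound) (y-P≤x x=y±P)
  where
  P = 2 ^ p
  y-P-bound : + (a + P + P) ℤ.- + P ℤ.≤ y ℤ.- + P
  y-P-bound = ℤP.+-monoˡ-≤ (ℤ.- + P) (subst (λ t → + t ℤ.≤ y) (regroup a P) a+2P≤y)
    where
    regroup : ∀ a P → a + 2 * P ≡ a + P + P
    regroup = ℕSolver.solve-∀
  y-P≤x : x IsStep y By p → y ℤ.- + P ℤ.≤ x
  y-P≤x (inj₁ refl) = ℤP.≤-trans (ℤP.i-j≤i y (+ P)) (ℤP.i≤i+j y (+ P))
  y-P≤x (inj₂ refl) = ℤP.≤-refl

classified-step : ∀ a p y x → Classified a (suc p) y → x IsStep y By p → Classified a p x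
classified-step a p y x (inj₁ y-odd) step = inj₁ (twoPowOdd-step p y x y-odd step)
classified-step a p y x (inj₂ y-big) step = inj₂ (margin-step a p y x y-big step)

partialSum-≥ : ∀ n b → 2 ^ (n ∸ 1) ≤ partialSum n (suc b)
partialSum-≥ n zero = ℕP.≤-refl
partialSum-≥ n (suc b) = ℕP.≤-trans (partialSum-≥ n b) (ℕP.m≤m+n _ _)

InG-≥ : ∀ n d → InG n d → + (2 ^ (n ∸ 1)) ℤ.≤ d
InG-≥ n d (suc b , _ , _ , refl) = ℤ.+≤+ (partialSum-≥ n b)

module Levels (n : ℕ) (l : ℕ → ℤ) (isL : IsLSeq n l) where

  A : ℕ
  A = 2 ^ (n ∸ 1)

  -- l(1) = A and each increment is ≥ A, so every later term is ≥ 2A.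
  later-terms-≥ : ∀ k → + (A + A) ℤ.≤ l (suc (suc k))
  later-terms-≥ zero = subst₂ ℤ._≤_ (sym (ℤP.pos-+ A A)) (add-back (l 1) (l 2))
    (ℤP.+-mono-≤ (ℤP.≤-reflexive (sym (proj₁ isL))) (InG-≥ n _ (proj₂ (proj₂ isL) 1 (s≤s z≤n))))
    where
    add-back : ∀ a b → a ℤ.+ (b ℤ.- a) ≡ b
    add-back = ℤSolver.solve-∀
  later-terms-≥ (suc k) = ℤP.≤-trans (later-terms-≥ k) (proj₁ (proj₂ isL) (suc (suc k)) (s≤s z≤n))

  classify : ∀ j → suc j ≤ n → ∀ x → InD l n (suc j) x → Classified A (n ∸ suc j) x
  classify zero _ x (suc zero , _ , refl) = inj₁ (0 , trans (proj₁ isL) (cong +_ (sym (ℕP.*-identityʳ A))))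
  classify zero _ x (suc (suc k) , _ , refl) = inj₂ (later-terms-≥ k)
  classify (suc j) j+2≤n x (y , y∈D , x=y±P) =
    classified-step A (n ∸ suc (suc j)) y x
      (subst (λ p → Classified A p y) (∸-peel j+2≤n) (classify j (ℕP.<⇒≤ j+2≤n) y y∈D)) x=y±P

  realize : ∀ j → suc j ≤ n → ∀ q → q < 2 ^ j → InD l n (suc j) (+ (2 ^ (n ∸ suc j) * (2 * q + 1)))
  realize zero _ zero _ = 1 , s≤s z≤n , trans (cong +_ (ℕP.*-identityʳ A)) (sym (proj₁ isL))
  realize zero _ (suc q) (s≤s ())
  realize (suc j) j+2≤n q q<2^j+1 with twoPowOdd-parent (n ∸ suc (suc j)) q (2 ^ j) q<2^j+1
  ... | r , r<2^j , x=y±P =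
    _ , subst (λ p → InD l n (suc j) (+ (2 ^ p * (2 * r + 1)))) (∸-peel j+2≤n)
          (realize j (ℕP.<⇒≤ j+2≤n) r r<2^j) , x=y±P

  below-A : ∀ j → suc j ≤ n → ∀ m → m < A → InD l n (suc j) (+ m) ⇔ InTwoPowOdd (n ∸ suc j) (+ m)
  below-A j j<n m m<A = mk⇔ to from
    where
    to : InD l n (suc j) (+ m) → InTwoPowOdd (n ∸ suc j) (+ m)
    to m∈D with classify j j<n (+ m) m∈D
    ... | inj₁ m-odd = m-odd
    ... | inj₂ m-big = contradiction (ℤP.drop‿+≤+ m-big) (ℕP.<⇒≱ (ℕP.<-≤-trans m<A (ℕP.m≤m+n A _)))
    from : InTwoPowOdd (n ∸ suc j) (+ m) → InD l n (suc j) (+ m)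
    from (q , m≡) = subst (InD l n (suc j)) (sym m≡) (realize j j<n q q<2^j)
      where
      P = 2 ^ (n ∸ suc j)
      2^n-split : P * 2 ^ suc j ≡ 2 ^ n
      2^n-split = trans (sym (ℕP.^-distribˡ-+-* 2 (n ∸ suc j) (suc j))) (cong (2 ^_) (ℕP.m∸n+n≡m j<n))
      odd<2^j+1 : 2 * q + 1 < 2 * 2 ^ j
      odd<2^j+1 = ℕP.*-cancelˡ-< P _ _ (subst₂ _<_ (ℤP.+-injective m≡) (sym 2^n-split)
                    (ℕP.<-≤-trans m<A (ℕP.^-monoʳ-≤ 2 (ℕP.m∸n≤m n 1))))
      q<2^j : q < 2 ^ j
      q<2^j = ℕP.*-cancelˡ-< 2 q (2 ^ j) (ℕP.≤-trans (s≤s (ℕP.m≤m+n (2 * q) 1)) odd<2^j+1)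

-- For n > m the fixed m lies below 2^(n-1); then level n-e = (n-e-1)+1 of
-- D_{·,n} is described by below-A with exponent n-(n-e) = e.
theorem2p18 : (l : ℕ → ℕ → ℤ) → (∀ n → 2 ≤ n → IsLSeq n (l n)) →
    (e : ℕ) → (m : ℕ) → 1 ≤ m →
    ∃[ N ] (∀ n → N ≤ n → 2 ≤ n → e < n →
    (InD (l n) n (n ∸ e) (+ m) ⇔ InTwoPowOdd e (+ m)))
theorem2p18 l isL e m _ = suc m , levels-agree
  where
  levels-agree : ∀ n → suc m ≤ n → 2 ≤ n → e < n → InD (l n) n (n ∸ e) (+ m) ⇔ InTwoPowOdd e (+ m)
  levels-agree n m<n 2≤n e<n =
    subst₂ (λ i p → InD (l n) n i (+ m) ⇔ InTwoPowOdd p (+ m)) (sym level) exponent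
      (Levels.below-A n (l n) (isL n 2≤n) (n ∸ suc e) (ℕP.∸-monoʳ-< z<s e<n) m m<A)
    where
    level : n ∸ e ≡ suc (n ∸ suc e)
    level = ∸-peel e<n
    exponent : n ∸ suc (n ∸ suc e) ≡ e
    exponent = trans (cong (n ∸_) (sym level)) (ℕP.m∸[m∸n]≡n (ℕP.<⇒≤ e<n))
    m<A : m < 2 ^ (n ∸ 1)
    m<A = ℕP.≤-<-trans (ℕP.∸-monoˡ-≤ 1 m<n) (n<2^n (n ∸ 1))
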